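{- Let the central Delannoy numbers $D(n)$ be defined by $D(0)=1$, $D(1)=3$ and $D(n)=\frac{3(2n-1)}{n}D(n-1)-\frac{n-1}{n}D(n-2)$ for $n\geq 2$. The sequence $\{D(n)\}_{n\geq 0}$ is ratio log-concave.
   Context: A sequence $(x_n)_{n\ge m}$ of positive reals is log-concave if $x_n^2\ge x_{n-1}x_{n+1}$ for all $n\ge m+1$. A sequence $(a_n)_{n\ge m}$ of positive reals is ratio log-concave if $(a_{n+1}/a_n)_{n\ge m}$ is log-concave. -}

module Defs where

open import Data.Nat using (ℕ; zero; suc)
import Data.Nat as ℕ
open import Data.Integer using (+_)
open import Data.Rational using (ℚ; 0ℚ; 1ℚ; _+_; _-_; _*_; _÷_; _/_; _<_; _≤_; >-nonZero)
open import Data.Product using (Σ; _×_)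

-- Central Delannoy numbers, defined exactly by the recurrence, as rationals:
-- D 0 = 1, D 1 = 3, D n = (3(2n-1)/n) D(n-1) - ((n-1)/n) D(n-2) for n ≥ 2.
-- In the clause below n = k + 2, so 2n-1 = 2k+3 and n-1 = k+1.
D : ℕ → ℚ
D zero = 1ℚ
D (suc zero) = + 3 / 1
D (suc (suc k)) =
  ((+ (3 ℕ.* (2 ℕ.* k ℕ.+ 3)) / (suc (suc k))) * D (suc k))
  - ((+ (k ℕ.+ 1) / (suc (suc k))) * D k)

LogConcave : (ℕ → ℚ) → Set
LogConcave x =
  (∀ n → 0ℚ < x n) ×
  (∀ n → x n * x (suc (suc n)) ≤ x (suc n) * x (suc n))

RatioLogConcave : (ℕ → ℚ) → Set
RatioLogConcave a =
  Σ (∀ n → 0ℚ < a n) λ pos →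
    LogConcave (λ n → _÷_ (a (suc n)) (a n) {{>-nonZero (pos n)}})

-- Write u, v, w, z for four consecutive Delannoy numbers D n, …, D (n + 3) and N for n.
-- Ratio log-concavity at n is v³ z ≤ u w³.  Two bounds on the ratio v / u propagate along
-- the recurrence: v ≥ 3 u, and Q N u v ≥ 0, i.e. α(N) t² − β(N) t + γ(N) ≤ 0 at t = v / u.
-- The second one survives a step because α(N) (N + 2)² Q (N + 1) v w, after eliminating w
-- by the recurrence, is a combination of Q N u v, u (v − 3u) and u² whose coefficients are
-- polynomials in N − 1 with natural coefficients.  Likewise, once w and z are eliminated, a
-- positive multiple of u w³ − v³ z is a combination of Q N u v and monomials in u and v − 3u
-- with coefficients that are polynomials in N − 2 with natural coefficients.

module Submission where

open import Algebra.Bundles.Raw using (RawRing)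
open import Data.List using (List; []; _∷_)
open import Data.Nat as ℕ using (ℕ; suc; z≤n; s≤s)
open import Level using (0ℓ)

-- The expressions of the proof, over any raw ring: at ℚ they are the quantities of the proof,
-- at the solver's polynomial syntax (module P below) they are their reflections, which
-- evaluate back to them definitionally.  This module precedes the opening of Data.Rational
-- so that the operations of R are unambiguous in it.
module Expressions (R : RawRing 0ℓ 0ℓ) (#_ : ℕ → RawRing.Carrier R) where
  open RawRing R

  infixl 6 _-_
  _-_ : Carrier → Carrier → Carrier
  x - y = x + - y

  horner : List ℕ → Carrier → Carrier
  horner []       x = 0#
  horner (c ∷ cs) x = # c + x * horner cs x

  next : Carrier → Carrier → Carrier → Carrier
  next N u v = # 3 * (# 2 * N + # 3) * v - (N + # 1) * u

  α β γ : Carrier → Carrier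
  α N = # 2 * N * N + # 4 * N + # 4
  β N = # 12 * N * N + # 18 * N + # 18
  γ N = # 2 * N * N + # 2 * N + # 3

  Q : Carrier → Carrier → Carrier → Carrier
  Q N u v = β N * (u * v) - α N * (v * v) - γ N * (u * u)

open import Defs
open import Data.Integer as ℤ using (+_)
import Data.Integer.Properties as ℤ
open import Data.Product using (_×_; _,_; proj₁)
open import Data.Rational
open import Data.Rational.Literals using (fromℤ)
open import Data.Rational.Properties
import Data.Rational.Unnormalised.Base as ℚᵘ
import Data.Rational.Unnormalised.Properties as ℚᵘ
open import Data.Rational.Solver using (module +-*-Solver)
open +-*-Solver using (Polynomial; con; solve; _:=_; _:+_; _:*_; :-_; _:-_)
open import Relation.Binary.PropositionalEquality
open import Relation.Nullary.Decidable using (Dec; from-yes; _×-dec_)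

#_ : ℕ → ℚ
# n = fromℤ (+ n)

#-+ : ∀ m n → # (m ℕ.+ n) ≡ # m + # n
#-+ m n = toℚᵘ-injective (ℚᵘ.≃-trans (ℚᵘ.*≡* eq) (ℚᵘ.≃-sym (toℚᵘ-homo-+ (# m) (# n))))
  where
  eq : + (m ℕ.+ n) ℤ.* + 1 ≡ (+ m ℤ.* + 1 ℤ.+ + n ℤ.* + 1) ℤ.* + 1
  eq = cong (ℤ._* + 1)
         (trans (ℤ.pos-+ m n) (sym (cong₂ ℤ._+_ (ℤ.*-identityʳ (+ m)) (ℤ.*-identityʳ (+ n)))))

#-* : ∀ m n → # (m ℕ.* n) ≡ # m * # n
#-* m n = toℚᵘ-injective (ℚᵘ.≃-trans (ℚᵘ.*≡* eq) (ℚᵘ.≃-sym (toℚᵘ-homo-* (# m) (# n))))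
  where
  eq : + (m ℕ.* n) ℤ.* + 1 ≡ (+ m ℤ.* + n) ℤ.* + 1
  eq = cong (ℤ._* + 1) (ℤ.pos-* m n)

#-suc : ∀ n → # suc n ≡ # n + # 1
#-suc n = trans (#-+ 1 n) (+-comm (# 1) (# n))

#-mono-≤ : ∀ {m n} → m ℕ.≤ n → # m ≤ # n
#-mono-≤ m≤n = *≤* (subst₂ ℤ._≤_ (sym (ℤ.*-identityʳ _)) (sym (ℤ.*-identityʳ _)) (ℤ.+≤+ m≤n))

+m/n*n≡m : ∀ m n → (+ m / suc n) * # suc n ≡ # m
+m/n*n≡m m n = toℚᵘ-injective
  (ℚᵘ.≃-trans (toℚᵘ-homo-* (+ m / suc n) (# suc n))
  (ℚᵘ.≃-trans (ℚᵘ.*-congʳ (toℚᵘ-fromℚᵘ (ℚᵘ.mkℚᵘ (+ m) n)))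
              (ℚᵘ.*≡* (ℤ.*-assoc (+ m) (+ suc n) (+ 1)))))

polynomialRawRing : ℕ → RawRing 0ℓ 0ℓ
polynomialRawRing n = record
  { Carrier = Polynomial n
  ; _≈_     = _≡_
  ; _+_     = _:+_
  ; _*_     = _:*_
  ; -_      = :-_
  ; 0#      = con 0ℚ
  ; 1#      = con 1ℚ
  }

κ : ∀ {n} → ℕ → Polynomial n
κ k = con (# k)

module P {n} = Expressions (polynomialRawRing n) κ
open Expressions +-*-rawRing #_ using (horner; next; α; Q)

private
  variable
    p q r x N u v w z : ℚ

*-nonNeg : 0ℚ ≤ p → 0ℚ ≤ q → 0ℚ ≤ p * q
*-nonNeg {p} {q} 0≤p 0≤q =
  subst (_≤ p * q) (*-zeroˡ q) (*-monoʳ-≤-nonNeg q {{nonNegative 0≤q}} 0≤p)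

*-pos : 0ℚ < p → 0ℚ < q → 0ℚ < p * q
*-pos {p} {q} 0<p 0<q = positive⁻¹ (p * q) {{pos*pos⇒pos p {{positive 0<p}} q {{positive 0<q}}}}

÷-pos : 0ℚ < p → (0<q : 0ℚ < q) → 0ℚ < (p ÷ q) {{>-nonZero 0<q}}
÷-pos {p} {q} 0<p 0<q = positive⁻¹ _
  {{pos*pos⇒pos p {{positive 0<p}} ((1/ q) {{>-nonZero 0<q}}) {{1/pos⇒pos q {{positive 0<q}}}}}}

pos*-reflects-nonNeg : 0ℚ < r → 0ℚ ≤ r * p → 0ℚ ≤ p
pos*-reflects-nonNeg {r} {p} 0<r 0≤rp =
  *-cancelˡ-≤-pos r {{positive 0<r}} (subst (_≤ r * p) (sym (*-zeroʳ r)) 0≤rp)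

p≤q⇒0≤q-p : p ≤ q → 0ℚ ≤ q - p
p≤q⇒0≤q-p {p} {q} p≤q = subst (_≤ q - p) (+-inverseʳ p) (+-monoˡ-≤ (- p) p≤q)

0≤q-p⇒p≤q : ∀ {p q} → 0ℚ ≤ q - p → p ≤ q
0≤q-p⇒p≤q {p} {q} 0≤q-p = subst₂ _≤_ (+-identityʳ p) p+[q-p]≡q (+-monoʳ-≤ p 0≤q-p)
  where
  p+[q-p]≡q : p + (q - p) ≡ q
  p+[q-p]≡q = solve 2 (λ p q → p :+ (q :- p) := q) refl p q

horner-nonNeg : ∀ cs → 0ℚ ≤ x → 0ℚ ≤ horner cs x
horner-nonNeg []       0≤x = ≤-refl
horner-nonNeg (c ∷ cs) 0≤x = +-mono-≤ (nonNegative⁻¹ (# c)) (*-nonNeg 0≤x (horner-nonNeg cs 0≤x))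

α-pos : 0ℚ ≤ N → 0ℚ < α N
α-pos 0≤N = +-mono-≤-< (+-mono-≤ (*-nonNeg (*-nonNeg (nonNegative⁻¹ (# 2)) 0≤N) 0≤N)
                                 (*-nonNeg (nonNegative⁻¹ (# 4)) 0≤N))
                       (positive⁻¹ (# 4))

Q-homogeneous : ∀ N c u v → Q N (c * u) (c * v) ≡ c * c * Q N u v
Q-homogeneous = solve 4 (λ N c u v → P.Q N (c :* u) (c :* v) := c :* c :* P.Q N u v) refl

Recurrence : ℚ → ℚ → ℚ → ℚ → Set
Recurrence N u v w = (N + # 2) * w ≡ next N u v

RatioBounds : ℚ → ℚ → ℚ → Set
RatioBounds N u v = 0ℚ < u × # 3 * u ≤ v × 0ℚ ≤ Q N u v

ratioBounds? : ∀ N u v → Dec (RatioBounds N u v)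
ratioBounds? N u v = (0ℚ <? u) ×-dec (# 3 * u ≤? v) ×-dec (0ℚ ≤? Q N u v)

ratioBounds-step : # 1 ≤ N → Recurrence N u v w → RatioBounds N u v → RatioBounds (N + # 1) v w
ratioBounds-step {N} {u} {v} {w} 1≤N rec (0<u , 3u≤v , 0≤Q) = 0<v , 3v≤w , 0≤Q′
  where
  open ≡-Reasoning
  0≤N-1 : 0ℚ ≤ N - # 1
  0≤N-1 = p≤q⇒0≤q-p 1≤N
  0≤N : 0ℚ ≤ N
  0≤N = ≤-trans (nonNegative⁻¹ (# 1)) 1≤N
  0<N+2 : 0ℚ < N + # 2
  0<N+2 = +-mono-≤-< 0≤N (positive⁻¹ (# 2))
  0≤u : 0ℚ ≤ u
  0≤u = <⇒≤ 0<u
  0≤v-3u : 0ℚ ≤ v - # 3 * u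
  0≤v-3u = p≤q⇒0≤q-p 3u≤v

  0<v : 0ℚ < v
  0<v = <-≤-trans (*-pos (positive⁻¹ (# 3)) 0<u) 3u≤v

  3v≤w : # 3 * v ≤ w
  3v≤w = 0≤q-p⇒p≤q (pos*-reflects-nonNeg 0<N+2 (subst (0ℚ ≤_) (sym identity) 0≤rhs))
    where
    rhs : ℚ
    rhs = (N + # 1) * (# 3 * (v - # 3 * u) + # 8 * u)
    identity : (N + # 2) * (w - # 3 * v) ≡ rhs
    identity = begin
      (N + # 2) * (w - # 3 * v)
        ≡⟨ solve 3 (λ N v w → (N :+ κ 2) :* (w :- κ 3 :* v) := (N :+ κ 2) :* w :- κ 3 :* ((N :+ κ 2) :* v))
                   refl N v w ⟩
      (N + # 2) * w - # 3 * ((N + # 2) * v)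
        ≡⟨ cong (_- # 3 * ((N + # 2) * v)) rec ⟩
      next N u v - # 3 * ((N + # 2) * v)
        ≡⟨ solve 3 (λ N u v → P.next N u v :- κ 3 :* ((N :+ κ 2) :* v)
                              := (N :+ κ 1) :* (κ 3 :* (v :- κ 3 :* u) :+ κ 8 :* u))
                   refl N u v ⟩
      rhs ∎
    0≤rhs : 0ℚ ≤ rhs
    0≤rhs = *-nonNeg (+-mono-≤ 0≤N (nonNegative⁻¹ (# 1)))
                     (+-mono-≤ (*-nonNeg (nonNegative⁻¹ (# 3)) 0≤v-3u) (*-nonNeg (nonNegative⁻¹ (# 8)) 0≤u))

  0≤Q′ : 0ℚ ≤ Q (N + # 1) v w
  0≤Q′ = pos*-reflects-nonNeg (*-pos (α-pos 0≤N) (*-pos 0<N+2 0<N+2)) (subst (0ℚ ≤_) (sym identity) 0≤rhs)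
    where
    -- Certificate found by computer; coefficient lists start with the constant term.
    a b c : List ℕ
    a = 45 ∷ 144 ∷ 93 ∷ 22 ∷ 2 ∷ []
    b = 3720 ∷ 4842 ∷ 2316 ∷ 390 ∷ []
    c = 10675 ∷ 13884 ∷ 6609 ∷ 1106 ∷ []
    rhs : ℚ
    rhs = horner a (N - # 1) * Q N u v + u * (horner b (N - # 1) * (v - # 3 * u)) + u * u * horner c (N - # 1)
    identity : α N * ((N + # 2) * (N + # 2)) * Q (N + # 1) v w ≡ rhs
    identity = begin
      α N * ((N + # 2) * (N + # 2)) * Q (N + # 1) v w
        ≡⟨ *-assoc (α N) ((N + # 2) * (N + # 2)) (Q (N + # 1) v w) ⟩
      α N * ((N + # 2) * (N + # 2) * Q (N + # 1) v w)
        ≡⟨ cong (α N *_) (Q-homogeneous (N + # 1) (N + # 2) v w) ⟨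
      α N * Q (N + # 1) ((N + # 2) * v) ((N + # 2) * w)
        ≡⟨ cong (λ W → α N * Q (N + # 1) ((N + # 2) * v) W) rec ⟩
      α N * Q (N + # 1) ((N + # 2) * v) (next N u v)
        ≡⟨ solve 3 (λ N u v → P.α N :* P.Q (N :+ κ 1) ((N :+ κ 2) :* v) (P.next N u v)
                              := P.horner a (N :- κ 1) :* P.Q N u v
                                 :+ u :* (P.horner b (N :- κ 1) :* (v :- κ 3 :* u))
                                 :+ u :* u :* P.horner c (N :- κ 1))
                   refl N u v ⟩
      rhs ∎
    0≤rhs : 0ℚ ≤ rhs
    0≤rhs = +-mono-≤ (+-mono-≤ (*-nonNeg (horner-nonNeg a 0≤N-1) 0≤Q)
                               (*-nonNeg 0≤u (*-nonNeg (horner-nonNeg b 0≤N-1) 0≤v-3u)))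
                     (*-nonNeg (*-nonNeg 0≤u 0≤u) (horner-nonNeg c 0≤N-1))

bounds⇒v³z≤uw³ : # 2 ≤ N → RatioBounds N u v → Recurrence N u v w → Recurrence (N + # 1) v w z →
                 v * v * v * z ≤ u * w * w * w
bounds⇒v³z≤uw³ {N} {u} {v} {w} {z} 2≤N (0<u , 3u≤v , 0≤Q) recW recZ =
  0≤q-p⇒p≤q (pos*-reflects-nonNeg 0<K (subst (0ℚ ≤_) (sym identity) 0≤rhs))
  where
  open ≡-Reasoning
  0≤N-2 : 0ℚ ≤ N - # 2
  0≤N-2 = p≤q⇒0≤q-p 2≤N
  0≤N : 0ℚ ≤ N
  0≤N = ≤-trans (nonNegative⁻¹ (# 2)) 2≤N
  0≤u : 0ℚ ≤ u
  0≤u = <⇒≤ 0<u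
  0≤v-3u : 0ℚ ≤ v - # 3 * u
  0≤v-3u = p≤q⇒0≤q-p 3u≤v

  α³ K W : ℚ
  α³ = α N * α N * α N
  K  = α³ * ((N + # 3) * ((N + # 2) * (N + # 2) * (N + # 2)))
  W  = (N + # 2) * w

  0<K : 0ℚ < K
  0<K = *-pos (*-pos (*-pos 0<α 0<α) 0<α)
              (*-pos (+-mono-≤-< 0≤N (positive⁻¹ (# 3))) (*-pos (*-pos 0<N+2 0<N+2) 0<N+2))
    where
    0<α : 0ℚ < α N
    0<α = α-pos 0≤N
    0<N+2 : 0ℚ < N + # 2
    0<N+2 = +-mono-≤-< 0≤N (positive⁻¹ (# 2))

  G F : ℚ → ℚ
  G Z = α³ * ((N + # 3) * u * (W * W * W) - (N + # 2) * (N + # 2) * (N + # 2) * (v * v * v) * Z)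
  F X = α³ * ((N + # 3) * u * (X * X * X) - (N + # 2) * (N + # 2) * (v * v * v) * next (N + # 1) ((N + # 2) * v) X)

  ss su uu uus uuu : List ℕ
  ss  = 3526400 ∷ 7786880 ∷ 7581424 ∷ 4246560 ∷ 1495312 ∷ 338640 ∷ 48124 ∷ 3920 ∷ 140 ∷ []
  su  = 20102640 ∷ 44304624 ∷ 43090488 ∷ 24121584 ∷ 8489664 ∷ 1921488 ∷ 272832 ∷ 22200 ∷ 792 ∷ []
  uu  = 28479144 ∷ 62532344 ∷ 60792996 ∷ 34076364 ∷ 12015062 ∷ 2722888 ∷ 386658 ∷ 31428 ∷ 1120 ∷ []
  uus = 16143552 ∷ 56730192 ∷ 73179024 ∷ 49008672 ∷ 19009620 ∷ 4336356 ∷ 542964 ∷ 28908 ∷ []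
  uuu = 45983016 ∷ 161544696 ∷ 208274660 ∷ 139370700 ∷ 54002230 ∷ 12302888 ∷ 1538210 ∷ 81764 ∷ []

  s rhs : ℚ
  s   = v - # 3 * u
  rhs = (horner ss (N - # 2) * (s * s) + horner su (N - # 2) * (s * u) + horner uu (N - # 2) * (u * u)) * Q N u v
        + u * u * u * (horner uus (N - # 2) * s + horner uuu (N - # 2) * u)

  identity : K * (u * w * w * w - v * v * v * z) ≡ rhs
  identity = begin
    K * (u * w * w * w - v * v * v * z)
      ≡⟨ solve 5 (λ N u v w z →
             P.α N :* P.α N :* P.α N :* ((N :+ κ 3) :* ((N :+ κ 2) :* (N :+ κ 2) :* (N :+ κ 2)))
               :* (u :* w :* w :* w :- v :* v :* v :* z)
           := P.α N :* P.α N :* P.α N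
                :* ((N :+ κ 3) :* u :* (((N :+ κ 2) :* w) :* ((N :+ κ 2) :* w) :* ((N :+ κ 2) :* w))
                    :- (N :+ κ 2) :* (N :+ κ 2) :* (N :+ κ 2) :* (v :* v :* v) :* ((N :+ κ 1 :+ κ 2) :* z)))
           refl N u v w z ⟩
    G ((N + # 1 + # 2) * z)
      ≡⟨ cong G recZ ⟩
    G (next (N + # 1) v w)
      ≡⟨ solve 4 (λ N u v w →
             P.α N :* P.α N :* P.α N
               :* ((N :+ κ 3) :* u :* (((N :+ κ 2) :* w) :* ((N :+ κ 2) :* w) :* ((N :+ κ 2) :* w))
                   :- (N :+ κ 2) :* (N :+ κ 2) :* (N :+ κ 2) :* (v :* v :* v) :* P.next (N :+ κ 1) v w)
           := P.α N :* P.α N :* P.α N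
                :* ((N :+ κ 3) :* u :* (((N :+ κ 2) :* w) :* ((N :+ κ 2) :* w) :* ((N :+ κ 2) :* w))
                    :- (N :+ κ 2) :* (N :+ κ 2) :* (v :* v :* v)
                         :* P.next (N :+ κ 1) ((N :+ κ 2) :* v) ((N :+ κ 2) :* w)))
           refl N u v w ⟩
    F W
      ≡⟨ cong F recW ⟩
    F (next N u v)
      ≡⟨ solve 3 (λ N u v →
             P.α N :* P.α N :* P.α N
               :* ((N :+ κ 3) :* u :* (P.next N u v :* P.next N u v :* P.next N u v)
                   :- (N :+ κ 2) :* (N :+ κ 2) :* (v :* v :* v)
                        :* P.next (N :+ κ 1) ((N :+ κ 2) :* v) (P.next N u v))
           := (P.horner ss (N :- κ 2) :* ((v :- κ 3 :* u) :* (v :- κ 3 :* u))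
               :+ P.horner su (N :- κ 2) :* ((v :- κ 3 :* u) :* u)
               :+ P.horner uu (N :- κ 2) :* (u :* u)) :* P.Q N u v
              :+ u :* u :* u :* (P.horner uus (N :- κ 2) :* (v :- κ 3 :* u) :+ P.horner uuu (N :- κ 2) :* u))
           refl N u v ⟩
    rhs ∎

  0≤rhs : 0ℚ ≤ rhs
  0≤rhs = +-mono-≤
    (*-nonNeg (+-mono-≤ (+-mono-≤ (*-nonNeg (horner-nonNeg ss 0≤N-2) (*-nonNeg 0≤v-3u 0≤v-3u))
                                  (*-nonNeg (horner-nonNeg su 0≤N-2) (*-nonNeg 0≤v-3u 0≤u)))
                        (*-nonNeg (horner-nonNeg uu 0≤N-2) (*-nonNeg 0≤u 0≤u)))
              0≤Q)
    (*-nonNeg (*-nonNeg (*-nonNeg 0≤u 0≤u) 0≤u)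
              (+-mono-≤ (*-nonNeg (horner-nonNeg uus 0≤N-2) 0≤v-3u) (*-nonNeg (horner-nonNeg uuu 0≤N-2) 0≤u)))

v³z≤uw³⇒ratios-logConcave : (0<u : 0ℚ < u) (0<v : 0ℚ < v) (0<w : 0ℚ < w) → v * v * v * z ≤ u * w * w * w →
  (v ÷ u) {{>-nonZero 0<u}} * (z ÷ w) {{>-nonZero 0<w}} ≤ (w ÷ v) {{>-nonZero 0<v}} * (w ÷ v) {{>-nonZero 0<v}}
v³z≤uw³⇒ratios-logConcave {u} {v} {w} {z} 0<u 0<v 0<w v³z≤uw³ =
  *-cancelʳ-≤-pos K {{positive 0<K}} (subst₂ _≤_ (sym lhs*K) (sym rhs*K) v³z≤uw³)
  where
  open ≡-Reasoning
  instance
    _ = >-nonZero 0<u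
    _ = >-nonZero 0<v
    _ = >-nonZero 0<w
  K : ℚ
  K = u * v * v * w
  0<K : 0ℚ < K
  0<K = *-pos (*-pos (*-pos 0<u 0<v) 0<v) 0<w
  lhs*K : (v * 1/ u) * (z * 1/ w) * K ≡ v * v * v * z
  lhs*K = begin
    (v * 1/ u) * (z * 1/ w) * K
      ≡⟨ solve 6 (λ u v w z u⁻¹ w⁻¹ → (v :* u⁻¹) :* (z :* w⁻¹) :* (u :* v :* v :* w)
                                    := v :* v :* v :* z :* ((u⁻¹ :* u) :* (w⁻¹ :* w)))
                 refl u v w z (1/ u) (1/ w) ⟩
    v * v * v * z * ((1/ u * u) * (1/ w * w))
      ≡⟨ cong₂ (λ a b → v * v * v * z * (a * b)) (*-inverseˡ u) (*-inverseˡ w) ⟩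
    v * v * v * z * 1ℚ
      ≡⟨ *-identityʳ (v * v * v * z) ⟩
    v * v * v * z ∎
  rhs*K : (w * 1/ v) * (w * 1/ v) * K ≡ u * w * w * w
  rhs*K = begin
    (w * 1/ v) * (w * 1/ v) * K
      ≡⟨ solve 4 (λ u v w v⁻¹ → (w :* v⁻¹) :* (w :* v⁻¹) :* (u :* v :* v :* w)
                              := u :* w :* w :* w :* ((v⁻¹ :* v) :* (v⁻¹ :* v)))
                 refl u v w (1/ v) ⟩
    u * w * w * w * ((1/ v * v) * (1/ v * v))
      ≡⟨ cong (λ a → u * w * w * w * (a * a)) (*-inverseˡ v) ⟩
    u * w * w * w * 1ℚ
      ≡⟨ *-identityʳ (u * w * w * w) ⟩
    u * w * w * w ∎

D-recurrence : ∀ k → Recurrence (# k) (D k) (D (suc k)) (D (suc (suc k)))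
D-recurrence k = begin
  (# k + # 2) * (A * D (suc k) - B * D k)
    ≡⟨ cong (_* (A * D (suc k) - B * D k)) (trans (+-comm (# k) (# 2)) (sym (#-+ 2 k))) ⟩
  # suc (suc k) * (A * D (suc k) - B * D k)
    ≡⟨ solve 5 (λ n A B u v → n :* (A :* v :- B :* u) := (A :* n) :* v :- (B :* n) :* u)
               refl (# suc (suc k)) A B (D k) (D (suc k)) ⟩
  (A * # suc (suc k)) * D (suc k) - (B * # suc (suc k)) * D k
    ≡⟨ cong₂ (λ a b → a * D (suc k) - b * D k)
             (+m/n*n≡m (3 ℕ.* (2 ℕ.* k ℕ.+ 3)) (suc k)) (+m/n*n≡m (k ℕ.+ 1) (suc k)) ⟩
  # (3 ℕ.* (2 ℕ.* k ℕ.+ 3)) * D (suc k) - # (k ℕ.+ 1) * D k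
    ≡⟨ cong₂ (λ a b → a * D (suc k) - b * D k) #-numerator (#-+ k 1) ⟩
  next (# k) (D k) (D (suc k)) ∎
  where
  open ≡-Reasoning
  A B : ℚ
  A = + (3 ℕ.* (2 ℕ.* k ℕ.+ 3)) / suc (suc k)
  B = + (k ℕ.+ 1) / suc (suc k)
  #-numerator : # (3 ℕ.* (2 ℕ.* k ℕ.+ 3)) ≡ # 3 * (# 2 * # k + # 3)
  #-numerator = trans (#-* 3 (2 ℕ.* k ℕ.+ 3)) (cong (# 3 *_) (trans (#-+ (2 ℕ.* k) 3) (cong (_+ # 3) (#-* 2 k))))

D-ratioBounds : ∀ n → RatioBounds (# n) (D n) (D (suc n))
D-ratioBounds 0               = from-yes (ratioBounds? (# 0) (D 0) (D 1))
D-ratioBounds 1               = from-yes (ratioBounds? (# 1) (D 1) (D 2))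
D-ratioBounds (suc m@(suc _)) =
  subst (λ N → RatioBounds N (D (suc m)) (D (suc (suc m)))) (sym (#-suc m))
        (ratioBounds-step (#-mono-≤ {1} {m} (s≤s z≤n)) (D-recurrence m) (D-ratioBounds m))

D-v³z≤uw³ : ∀ n → let u = D n; v = D (suc n); w = D (suc (suc n)); z = D (suc (suc (suc n))) in
            v * v * v * z ≤ u * w * w * w
D-v³z≤uw³ 0                = from-yes (D 1 * D 1 * D 1 * D 3 ≤? D 0 * D 2 * D 2 * D 2)
D-v³z≤uw³ 1                = from-yes (D 2 * D 2 * D 2 * D 4 ≤? D 1 * D 3 * D 3 * D 3)
D-v³z≤uw³ m@(suc (suc _)) =
  bounds⇒v³z≤uw³ (#-mono-≤ {2} {m} (s≤s (s≤s z≤n))) (D-ratioBounds m) (D-recurrence m)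
    (subst (λ N → Recurrence N (D (suc m)) (D (suc (suc m))) (D (suc (suc (suc m)))))
           (#-suc m) (D-recurrence (suc m)))

theorem4p7 : RatioLogConcave D
theorem4p7 =
  D-pos ,
  (λ n → ÷-pos (D-pos (suc n)) (D-pos n)) ,
  (λ n → v³z≤uw³⇒ratios-logConcave (D-pos n) (D-pos (suc n)) (D-pos (suc (suc n))) (D-v³z≤uw³ n))
  where
  D-pos : ∀ n → 0ℚ < D n
  D-pos n = proj₁ (D-ratioBounds n)
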